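{- Let $\mathcal{V}$ be a quantaloid, and let $f:\mathbb{A}\to\mathbb{C}$, $g:\mathbb{B}\to\mathbb{C}$ be $\mathcal{V}$-functors. Let $\mathbb{A}\wedge_{\mathbb{C}}\mathbb{B}$ be the $\mathcal{V}$-category whose objects are pairs $(a,b)$ with $f(a)=g(b)$, with $(a,b)_+=a_+$ and homs $\mathbb{A}(a,a')\wedge\mathbb{B}(b,b')$, and let $\bar g:\mathbb{A}\wedge_{\mathbb{C}}\mathbb{B}\to\mathbb{A}$ be the projection $(a,b)\mapsto a$. Suppose $f$ is surjective on objects and satisfies $\mathbb{C}(c,c')\le\bigvee_{a,a'\,:\,f(a)=c,\ f(a')=c'}\mathbb{A}(a,a')$ for all $c,c'\in\mathrm{Obj}(\mathbb{C})$, and suppose $\bar g\in\mathbb{O}\mathrm{d}$. Then $g\in\mathbb{O}\mathrm{d}$.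
   Context: A quantaloid $\mathcal{V}$ is a small, locally ordered bicategory whose hom-posets are complete lattices and which is biclosed (for every arrow $f$, $-\otimes f$ and $f\otimes -$ have right adjoints, $\otimes$ = horizontal composition in diagrammatic order); so $\otimes$ preserves arbitrary joins in each variable. A $\mathcal{V}$-category $\mathbb{A}$: a set $\mathrm{Obj}(\mathbb{A})$, a map $a\mapsto a_+\in\mathrm{Obj}(\mathcal{V})$, arrows $\mathbb{A}(a,b):a_+\to b_+$ with $id_{a_+}\le\mathbb{A}(a,a)$, $\mathbb{A}(a,b)\otimes\mathbb{A}(b,c)\le\mathbb{A}(a,c)$. A $\mathcal{V}$-functor $f:\mathbb{A}\to\mathbb{B}$: a map on objects with $(fa)_+=a_+$ and $\mathbb{A}(a,a')\le\mathbb{B}(fa,fa')$. A functional bisimulation is a $\mathcal{V}$-functor $f:\mathbb{A}\to\mathbb{B}$ with $\mathbb{B}(f(a),b)=\bigvee_{a':f(a')=b}\mathbb{A}(a,a')$ for all $a,b$. $\mathbb{O}\mathrm{d}$ denotes the class of functional bisimulations that are surjective on objects. -}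

module Defs where

open import Data.Product using (Σ; _×_; _,_; proj₁; proj₂; ∃)
open import Relation.Binary.PropositionalEquality using (_≡_; refl; sym; trans; cong; subst; subst₂)

-- A (small) quantaloid, with composition ⊗ written in diagrammatic order.
record Quantaloid : Set₁ where
  infixr 7 _⊗_
  infix 4 _≤_
  field
    Ob   : Set
    Hom  : Ob → Ob → Set
    _≤_  : ∀ {x y} → Hom x y → Hom x y → Set
    ≤-refl  : ∀ {x y} {u : Hom x y} → u ≤ u
    ≤-trans : ∀ {x y} {u v w : Hom x y} → u ≤ v → v ≤ w → u ≤ w
    ≤-antisym : ∀ {x y} {u v : Hom x y} → u ≤ v → v ≤ u → u ≡ v
    ⋁ : ∀ {x y} {I : Set} → (I → Hom x y) → Hom x y
    ⋁-upper : ∀ {x y} {I : Set} (h : I → Hom x y) (i : I) → h i ≤ ⋁ h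
    ⋁-least : ∀ {x y} {I : Set} (h : I → Hom x y) (u : Hom x y) →
              (∀ i → h i ≤ u) → ⋁ h ≤ u
    _∧_ : ∀ {x y} → Hom x y → Hom x y → Hom x y
    ∧-lower₁ : ∀ {x y} (u v : Hom x y) → (u ∧ v) ≤ u
    ∧-lower₂ : ∀ {x y} (u v : Hom x y) → (u ∧ v) ≤ v
    ∧-greatest : ∀ {x y} (u v w : Hom x y) → w ≤ u → w ≤ v → w ≤ (u ∧ v)
    idₕ : ∀ x → Hom x x
    _⊗_ : ∀ {x y z} → Hom x y → Hom y z → Hom x z
    ⊗-assoc : ∀ {w x y z} (u : Hom w x) (v : Hom x y) (t : Hom y z) →
              (u ⊗ v) ⊗ t ≡ u ⊗ (v ⊗ t)
    ⊗-idˡ : ∀ {x y} (u : Hom x y) → idₕ x ⊗ u ≡ u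
    ⊗-idʳ : ∀ {x y} (u : Hom x y) → u ⊗ idₕ y ≡ u
    ⊗-mono : ∀ {x y z} {u u' : Hom x y} {v v' : Hom y z} →
             u ≤ u' → v ≤ v' → u ⊗ v ≤ u' ⊗ v'
    _⇐_ : ∀ {x y z} → Hom x z → Hom y z → Hom x y
    ⇐-adj₁ : ∀ {x y z} (u : Hom x y) (f : Hom y z) (w : Hom x z) →
             u ⊗ f ≤ w → u ≤ w ⇐ f
    ⇐-adj₂ : ∀ {x y z} (u : Hom x y) (f : Hom y z) (w : Hom x z) →
             u ≤ w ⇐ f → u ⊗ f ≤ w
    _⇒_ : ∀ {x y z} → Hom x y → Hom x z → Hom y z
    ⇒-adj₁ : ∀ {x y z} (f : Hom x y) (u : Hom y z) (w : Hom x z) →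
             f ⊗ u ≤ w → u ≤ f ⇒ w
    ⇒-adj₂ : ∀ {x y z} (f : Hom x y) (u : Hom y z) (w : Hom x z) →
             u ≤ f ⇒ w → f ⊗ u ≤ w

  cast : ∀ {x x' y y'} → x ≡ x' → y ≡ y' → Hom x y → Hom x' y'
  cast p q u = subst₂ Hom p q u

module _ (V : Quantaloid) where
  open Quantaloid V

  record VCat : Set₁ where
    field
      Obj  : Set
      type : Obj → Ob
      hom  : (a b : Obj) → Hom (type a) (type b)
      hom-id   : ∀ a → idₕ (type a) ≤ hom a a
      hom-comp : ∀ a b c → hom a b ⊗ hom b c ≤ hom a c

  open VCat

  cast-id : ∀ {x x'} (p : x ≡ x') → cast p p (idₕ x) ≡ idₕ x'
  cast-id refl = refl

  cast-⊗ : ∀ {x x' y y' z z'} (p : x ≡ x') (q : y ≡ y') (r : z ≡ z')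
           (u : Hom x y) (v : Hom y z) → cast p q u ⊗ cast q r v ≡ cast p r (u ⊗ v)
  cast-⊗ refl refl refl u v = refl

  cast-mono : ∀ {x x' y y'} (p : x ≡ x') (q : y ≡ y') {u v : Hom x y} →
              u ≤ v → cast p q u ≤ cast p q v
  cast-mono refl refl h = h

  record VFun (A B : VCat) : Set where
    field
      map  : Obj A → Obj B
      type-pres : ∀ a → type B (map a) ≡ type A a
      hom-mono  : ∀ a a' →
        hom A a a' ≤ cast (type-pres a) (type-pres a') (hom B (map a) (map a'))

  open VFun

  SurjectiveOnObjects : ∀ {A B} → VFun A B → Set
  SurjectiveOnObjects {A} {B} f = ∀ (b : Obj B) → ∃ λ (a : Obj A) → map f a ≡ b

  FunctionalBisimulation : ∀ {A B} → VFun A B → Set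
  FunctionalBisimulation {A} {B} f =
    ∀ (a : Obj A) (b : Obj B) →
      cast (type-pres f a) refl (hom B (map f a) b)
        ≡ ⋁ {I = Σ (Obj A) (λ a' → map f a' ≡ b)}
            (λ { (a' , p) → cast refl (trans (sym (type-pres f a')) (cong (type B) p))
                                 (hom A a a') })

  Od : ∀ {A B} → VFun A B → Set
  Od f = FunctionalBisimulation f × SurjectiveOnObjects f

  HomCovering : ∀ {A C} → VFun A C → Set
  HomCovering {A} {C} f =
    ∀ (c c' : Obj C) →
      hom C c c' ≤ ⋁ {I = Σ (Obj A × Obj A) (λ { (a , a') → (map f a ≡ c) × (map f a' ≡ c') })}
        (λ { ((a , a') , (p , q)) →
               cast (trans (sym (type-pres f a)) (cong (type C) p))
                    (trans (sym (type-pres f a')) (cong (type C) q))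
                    (hom A a a') })

  module Pullback {A B C : VCat} (f : VFun A C) (g : VFun B C) where

    PObj : Set
    PObj = Σ (Obj A × Obj B) (λ { (a , b) → map f a ≡ map g b })

    tyEq : (x : PObj) → type B (proj₂ (proj₁ x)) ≡ type A (proj₁ (proj₁ x))
    tyEq ((a , b) , p) =
      trans (sym (type-pres g b)) (trans (cong (type C) (sym p)) (type-pres f a))

    phom : (x y : PObj) → Hom (type A (proj₁ (proj₁ x))) (type A (proj₁ (proj₁ y)))
    phom x y = hom A (proj₁ (proj₁ x)) (proj₁ (proj₁ y))
             ∧ cast (tyEq x) (tyEq y) (hom B (proj₂ (proj₁ x)) (proj₂ (proj₁ y)))

    PB : VCat
    PB = record { Obj = PObj ; type = λ x → type A (proj₁ (proj₁ x)) ; hom = phom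
                ; hom-id = pid ; hom-comp = pcomp }
      where
      pid : ∀ x → idₕ (type A (proj₁ (proj₁ x))) ≤ phom x x
      pid x = ∧-greatest _ _ _ (hom-id A _)
                (subst (_≤ cast (tyEq x) (tyEq x) (hom B (proj₂ (proj₁ x)) (proj₂ (proj₁ x)))) (cast-id (tyEq x)) (cast-mono (tyEq x) (tyEq x) (hom-id B _)))
      pcomp : ∀ x y z → phom x y ⊗ phom y z ≤ phom x z
      pcomp x y z = ∧-greatest _ _ _
        (≤-trans (⊗-mono (∧-lower₁ _ _) (∧-lower₁ _ _)) (hom-comp A _ _ _))
        (≤-trans (⊗-mono (∧-lower₂ _ _) (∧-lower₂ _ _))
           (subst (_≤ cast (tyEq x) (tyEq z) (hom B (proj₂ (proj₁ x)) (proj₂ (proj₁ z)))) (sym (cast-⊗ (tyEq x) (tyEq y) (tyEq z) _ _))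
              (cast-mono (tyEq x) (tyEq z) (hom-comp B _ _ _))))

    proj : VFun PB A
    proj = record { map = λ x → proj₁ (proj₁ x) ; type-pres = λ _ → refl
                  ; hom-mono = λ x y → ∧-lower₁ _ _ }

{-# OPTIONS --safe #-}
-- Surjectivity of g: lift c to a along f, then a to a pair (a , b) along ḡ.
-- For the hom equation, ⋁_{g b' = c} B(b, b') ≤ C(g b, c) holds for every V-functor.
-- Conversely, the covering hypothesis bounds C(g b, c) by the A(a, a') with f a = g b and
-- f a' = c; as (a , b) lies in the pullback and ḡ is a functional bisimulation,
-- A(a, a') = ⋁_{f a' = g b'} A(a, a') ∧ B(b, b') ≤ ⋁_{g b' = c} B(b, b').
module Submission where

open import Defs
open import Data.Product using (Σ; _×_; _,_; proj₁)
open import Relation.Binary.Bundles using (Poset)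
open import Relation.Binary.PropositionalEquality
  using (_≡_; refl; sym; trans; cong; isEquivalence)
import Relation.Binary.Reasoning.PartialOrder as PosetReasoning

open VCat
open VFun

module _ (V : Quantaloid) where
  open Quantaloid V

  ≤-reflexive : ∀ {x y} {u v : Hom x y} → u ≡ v → u ≤ v
  ≤-reflexive refl = ≤-refl

  homPoset : Ob → Ob → Poset _ _ _
  homPoset x y = record
    { Carrier = Hom x y
    ; _≈_ = _≡_
    ; _≤_ = _≤_
    ; isPartialOrder = record
      { isPreorder = record
        { isEquivalence = isEquivalence
        ; reflexive = ≤-reflexive
        ; trans = ≤-trans
        }
      ; antisym = ≤-antisym
      }
    }

  module ≤-Reasoning {x y : Ob} = PosetReasoning (homPoset x y)

  -- Relies on K: a cast depends only on its endpoints, not on the equality proofs.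
  cast-cast : ∀ {x x' x'' y y' y''} (p : x' ≡ x'') (q : y' ≡ y'') (p' : x ≡ x') (q' : y ≡ y')
              (p'' : x ≡ x'') (q'' : y ≡ y'') (u : Hom x y) →
              cast p q (cast p' q' u) ≡ cast p'' q'' u
  cast-cast refl refl refl refl refl refl u = refl

  cast-⋁ : ∀ {x x' y y'} {I : Set} (p : x ≡ x') (q : y ≡ y') (h : I → Hom x y) →
           cast p q (⋁ h) ≡ ⋁ (λ i → cast p q (h i))
  cast-⋁ refl refl h = refl

  module _ {A B : VCat V} (F : VFun V A B) where

    imageHom : (a : Obj A) (b : Obj B) → Hom (type A a) (type B b)
    imageHom a b = cast (type-pres F a) refl (hom B (map F a) b)

    fibreJoin : (a : Obj A) (b : Obj B) → Hom (type A a) (type B b)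
    fibreJoin a b = ⋁ {I = Σ (Obj A) (λ a' → map F a' ≡ b)}
      (λ { (a' , p) → cast refl (trans (sym (type-pres F a')) (cong (type B) p)) (hom A a a') })

    fibreJoin-upper : ∀ {a a' b} (p : map F a' ≡ b) (q : type A a' ≡ type B b) →
                      cast refl q (hom A a a') ≤ fibreJoin a b
    fibreJoin-upper {a} {a'} p q =
      ≤-trans (≤-reflexive (cast-cast refl q refl refl refl _ (hom A a a'))) (⋁-upper _ (a' , p))

    fibreJoin≤imageHom : ∀ a b → fibreJoin a b ≤ imageHom a b
    fibreJoin≤imageHom a b = ⋁-least _ _ λ where
      (a' , refl) →
        let q = trans (sym (type-pres F a')) refl in
        ≤-trans (cast-mono V refl q (hom-mono F a a'))
                (≤-reflexive (cast-cast refl q (type-pres F a) (type-pres F a') (type-pres F a) refl _))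

    functionalBisimulation-≤ : (∀ a b → imageHom a b ≤ fibreJoin a b) → FunctionalBisimulation V F
    functionalBisimulation-≤ imageHom≤fibreJoin a b =
      ≤-antisym (imageHom≤fibreJoin a b) (fibreJoin≤imageHom a b)

  module _ {A B C : VCat V} (f : VFun V A C) (g : VFun V B C) where
    open Pullback V f g

    surjective-from-proj : SurjectiveOnObjects V f → SurjectiveOnObjects V proj →
                           SurjectiveOnObjects V g
    surjective-from-proj f-surj proj-surj c =
      let (a , fa≡c) = f-surj c
          (((a' , b) , fa'≡gb) , a'≡a) = proj-surj a
      in b , trans (sym fa'≡gb) (trans (cong (map f) a'≡a) fa≡c)

    module _ (proj-bisim : FunctionalBisimulation V proj) where

      proj-bisim⇒hom≤fibreJoin :
        ∀ {a a' b c} (fa≡gb : map f a ≡ map g b) (fa'≡c : map f a' ≡ c)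
        (p : type A a ≡ type B b) (q : type A a' ≡ type C c) →
        cast p q (hom A a a') ≤ fibreJoin g b c
      proj-bisim⇒hom≤fibreJoin {a} {a'} {b} {c} fa≡gb fa'≡c p q = begin
        cast p q (hom A a a')   ≡⟨ cong (cast p q) (proj-bisim x a') ⟩
        cast p q (⋁ _)          ≡⟨ cast-⋁ p q _ ⟩
        ⋁ _                     ≤⟨ ⋁-least _ _ bound ⟩
        fibreJoin g b c         ∎
        where
        open ≤-Reasoning
        x : PObj
        x = (a , b) , fa≡gb
        bound : ∀ ((y , a''≡a') : Σ PObj (λ y → proj₁ (proj₁ y) ≡ a')) →
                cast p q (cast refl (trans refl (cong (type A) a''≡a')) (phom x y)) ≤ fibreJoin g b c
        bound ((y@((_ , b') , fa'≡gb') , refl)) = begin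
          cast p q (phom x y)                              ≤⟨ cast-mono V p q (∧-lower₂ _ _) ⟩
          cast p q (cast (tyEq x) (tyEq y) (hom B b b'))   ≡⟨ cast-cast p q (tyEq x) (tyEq y) refl r _ ⟩
          cast refl r (hom B b b')                         ≤⟨ fibreJoin-upper g gb'≡c r ⟩
          fibreJoin g b c                                  ∎
          where
          gb'≡c : map g b' ≡ c
          gb'≡c = trans (sym fa'≡gb') fa'≡c
          r : type B b' ≡ type C c
          r = trans (sym (type-pres g b')) (cong (type C) gb'≡c)

      homCovering⇒imageHom≤fibreJoin : HomCovering V f → ∀ b c → imageHom g b c ≤ fibreJoin g b c
      homCovering⇒imageHom≤fibreJoin f-cover b c = begin
        cast (type-pres g b) refl (hom C (map g b) c)   ≤⟨ cast-mono V (type-pres g b) refl (f-cover (map g b) c) ⟩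
        cast (type-pres g b) refl (⋁ _)                 ≡⟨ cast-⋁ (type-pres g b) refl _ ⟩
        ⋁ _                                             ≤⟨ ⋁-least _ _ bound ⟩
        fibreJoin g b c                                 ∎
        where
        open ≤-Reasoning
        bound : ∀ (((a , a') , _) : Σ (Obj A × Obj A) (λ (a , a') → (map f a ≡ map g b) × (map f a' ≡ c))) →
                cast (type-pres g b) refl (cast _ _ (hom A a a')) ≤ fibreJoin g b c
        bound ((a , a') , (fa≡gb , fa'≡c)) =
          ≤-trans (≤-reflexive (cast-cast (type-pres g b) refl p q (trans p (type-pres g b)) q (hom A a a')))
                  (proj-bisim⇒hom≤fibreJoin fa≡gb fa'≡c _ _)
          where
          p : type A a ≡ type C (map g b)
          p = trans (sym (type-pres f a)) (cong (type C) fa≡gb)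
          q : type A a' ≡ type C c
          q = trans (sym (type-pres f a')) (cong (type C) fa'≡c)

mainTheorem9 : (V : Quantaloid) (A B C : VCat V) (f : VFun V A C) (g : VFun V B C) →
    SurjectiveOnObjects V f →
    HomCovering V f →
    Od V (Pullback.proj V f g) →
    Od V g
mainTheorem9 V A B C f g f-surj f-cover (proj-bisim , proj-surj) =
    functionalBisimulation-≤ V g (homCovering⇒imageHom≤fibreJoin V f g proj-bisim f-cover)
  , surjective-from-proj V f g f-surj proj-surj
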